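{- Let $N$ be a node of an ACI-tableau and let $t\in\mathrm{garg}(\mathrm{lit}(N))$ be a term whose principal function symbol is a Skolem function $f_{\langle sp,i\rangle}$. Then $N$ is an introducer node for $t$, or $N$ has an ancestor that is an introducer node for $t$.
   Context: RQFO formulas are relational formulas generated by $F ::= \top\mid\bot\mid F\wedge F\mid F\vee F\mid\forall\mathbf{v}(\neg R\vee F)\mid\exists\mathbf{v}(R\wedge F)$ ($\mathbf{v}$ a possibly empty set of variables, $R$ an atom containing all of $\mathbf{v}$); $\neg F$ denotes the RQFO formula obtained by pushing negation inward. Positions of $F$: $\epsilon$ with $F|_\epsilon=F$; $p1,p2$ for the two arguments of $F|_p=G_1\wedge G_2$ or $G_1\vee G_2$; $p1$ for the matrix $G$ of $F|_p=\forall\mathbf{v}(\neg R\vee G)$ or $\exists\mathbf{v}(R\wedge G)$, writing $R_p=R$, $\mathbf{v}_p=\mathbf{v}$. $\mathbf{x}_p$: free variables of $F|_p$ in a fixed order; $D_p=d_p(\mathbf{x}_p)$ for fresh definer predicates $d_p$; for existential positions with $\mathbf{v}_p=\{x_1..x_n\}$, fresh Skolem functions $f_{\langle p,i\rangle}$ and $\sigma_p=\{x_i\mapsto f_{\langle p,i\rangle}(\mathbf{x}_p)\}$. The clausification of $F$ consists of clauses: $D_\epsilon$ (form 1); for $F|_p=\bot$: $\neg D_p$ (2); for $G\wedge H$: $\neg D_p\vee D_{p1}$, $\neg D_p\vee D_{p2}$ (3,4); for $G\vee H$: $\neg D_p\vee D_{p1}\vee D_{p2}$ (5); for $\forall\mathbf{v}(\neg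 R\vee G)$: $\neg D_p\vee\neg R_p\vee D_{p1}$ (6); for $\exists\mathbf{v}(R\wedge G)$: $\neg D_p\vee R_p\sigma_p$, $\neg D_p\vee D_{p1}\sigma_p$ (7,8). Given RQFO sentences $F,G$, the clausification of $F$ uses definers and Skolem functions indexed by $\mathrm{L}p$ (objects $D_{\mathrm{L}p}$, $R_{\mathrm{L}p}$, $\sigma_{\mathrm{L}p}$, $f_{\langle\mathrm{L}p,i\rangle}$), that of $\neg G$ disjoint ones indexed by $\mathrm{R}p$; $s\in\{\mathrm{L},\mathrm{R}\}$. A clausal tableau for a clausal formula $C$ is a finite ordered tree whose non-root nodes carry literal labels $\mathrm{lit}(N)$ such that for each node with children, the disjunction of the children's labels is an instance of a clause of $C$; a node is closed if an ancestor carries the complementary literal; the tableau is closed if all leaves are. A two-sided tableau for $C_{\mathrm{red}},C_{\mathrm{blue}}$ is a clausal tableau for $C_{\mathrm{red}}\wedge C_{\mathrm{blue}}$ with sides in $\{\mathrm{red},\mathrm{blue}\}$ on non-root nodes, equal among siblings, children of side $S$ forming an instance of a clause of $C_S$. An ACI-tableau (for $F$ and $G$) is a closed two-sided ground tableau for the clausification of $F$ (red) and of $\neg G$ (blue) that is regular (no node has an ancestor with the same label), leaf-only for the set of all negative literals occurring as labels (none of them labels an inner node), and contiguous for all pairs $\{R_{sp}\sigma_{sp}\mu,D_{sp1}\sigma_{sp}\mu\}$ ($\mu$ a ground substitution) of literals occurring as labels (if both label nodes on a common branch, one of these nodes is the parent of the other). $\mathrm{garg}(E)$ is the set of ground terms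 occurring as direct arguments of atoms in $E$. For a ground term $f_{\langle sp,i\rangle}(\mathbf{x}_{sp})\mu$ occurring in a literal label, its introducer literals are $R_{sp}\sigma_{sp}\mu$ and $D_{sp1}\sigma_{sp}\mu$; an introducer node for a ground term is a node whose literal label is an introducer literal for that term. -}

module Defs where

open import Data.Nat using (ℕ; zero; suc; _≟_)
open import Data.Bool using (Bool; true; false; not)
open import Data.List using (List; []; _∷_; _++_; map; filter; deduplicate)
open import Data.Maybe using (Maybe; just; nothing; maybe)
open import Data.Product using (Σ; _×_; _,_)
open import Data.Sum using (_⊎_)
open import Relation.Nullary using (¬_; ¬?)
open import Relation.Binary.PropositionalEquality using (_≡_; _≢_)
open import Data.List.Membership.Propositional using (_∈_; _∉_)
open import Data.List.Membership.DecPropositional _≟_ using (_∈?_)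
open import Data.List.Relation.Unary.Any using (Any)
open import Data.List.Relation.Unary.All using (All)
open import Data.List.Relation.Unary.Unique.Propositional using (Unique)
open import Data.List.Relation.Binary.Subset.Propositional using (_⊆_)

data Side : Set where
  L R : Side      -- L = clausification of F (red), R = of ¬G (blue)

-- positions: lists of child indices 1 / 2, read from the root; p1 = p ++ [1]
Pos : Set
Pos = List ℕ

data Arg : Set where
  avar : ℕ → Arg
  acon : ℕ → Arg

record Atom : Set where
  constructor atom
  field
    pred : ℕ
    argsA : List Arg
open Atom public

data Fm : Set where
  ⊤ᶠ ⊥ᶠ : Fm
  _∧ᶠ_ _∨ᶠ_ : Fm → Fm → Fm
  -- ∀ᶠ v R G  stands for  ∀v(¬R ∨ G);   ∃ᶠ v R G  for  ∃v(R ∧ G)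
  ∀ᶠ ∃ᶠ : List ℕ → Atom → Fm → Fm

varsArgs : List Arg → List ℕ
varsArgs [] = []
varsArgs (avar x ∷ as) = x ∷ varsArgs as
varsArgs (acon _ ∷ as) = varsArgs as

minus : List ℕ → List ℕ → List ℕ
minus xs v = filter (λ x → ¬? (x ∈? v)) xs

fv : Fm → List ℕ
fv ⊤ᶠ = []
fv ⊥ᶠ = []
fv (A ∧ᶠ B) = fv A ++ fv B
fv (A ∨ᶠ B) = fv A ++ fv B
fv (∀ᶠ v Rt G) = minus (varsArgs (argsA Rt) ++ fv G) v
fv (∃ᶠ v Rt G) = minus (varsArgs (argsA Rt) ++ fv G) v

data RQFO : Fm → Set where
  rq⊤ : RQFO ⊤ᶠ
  rq⊥ : RQFO ⊥ᶠ
  rq∧ : ∀ {A B} → RQFO A → RQFO B → RQFO (A ∧ᶠ B)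
  rq∨ : ∀ {A B} → RQFO A → RQFO B → RQFO (A ∨ᶠ B)
  rq∀ : ∀ {v Rt G} → Unique v → v ⊆ varsArgs (argsA Rt) → RQFO G → RQFO (∀ᶠ v Rt G)
  rq∃ : ∀ {v Rt G} → Unique v → v ⊆ varsArgs (argsA Rt) → RQFO G → RQFO (∃ᶠ v Rt G)

RQFOSentence : Fm → Set
RQFOSentence F = RQFO F × fv F ≡ []

negF : Fm → Fm
negF ⊤ᶠ = ⊥ᶠ
negF ⊥ᶠ = ⊤ᶠ
negF (A ∧ᶠ B) = negF A ∨ᶠ negF B
negF (A ∨ᶠ B) = negF A ∧ᶠ negF B
negF (∀ᶠ v Rt G) = ∃ᶠ v Rt (negF G)
negF (∃ᶠ v Rt G) = ∀ᶠ v Rt (negF G)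

subAt : Fm → Pos → Maybe Fm
subAt F [] = just F
subAt (A ∧ᶠ B) (1 ∷ p) = subAt A p
subAt (A ∧ᶠ B) (2 ∷ p) = subAt B p
subAt (A ∨ᶠ B) (1 ∷ p) = subAt A p
subAt (A ∨ᶠ B) (2 ∷ p) = subAt B p
subAt (∀ᶠ v Rt G) (1 ∷ p) = subAt G p
subAt (∃ᶠ v Rt G) (1 ∷ p) = subAt G p
subAt _ _ = nothing

-- x_p : free variables of F|_p in a fixed order (first occurrence)
xs : Fm → Pos → List ℕ
xs H p = maybe (λ K → deduplicate _≟_ (fv K)) [] (subAt H p)

data Term : Set where
  var : ℕ → Term
  con : ℕ → Term
  sk  : Side → Pos → ℕ → List Term → Term    -- sk s p i ts = f_<sp,i>(ts)

data GroundT : Term → Set where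
  gcon : ∀ {c} → GroundT (con c)
  gsk  : ∀ {s p i ts} → All GroundT ts → GroundT (sk s p i ts)

argT : Arg → Term
argT (avar x) = var x
argT (acon c) = con c

mutual
  sub : (ℕ → Term) → Term → Term
  sub θ (var x) = θ x
  sub θ (con c) = con c
  sub θ (sk s p i ts) = sk s p i (subs θ ts)

  subs : (ℕ → Term) → List Term → List Term
  subs θ [] = []
  subs θ (t ∷ ts) = sub θ t ∷ subs θ ts

data PSym : Set where
  inp : ℕ → PSym
  dfn : Side → Pos → PSym

record Lit : Set where
  constructor lit
  field
    sgn  : Bool            -- true = positive
    psym : PSym
    args : List Term       -- garg of a literal = its direct arguments
open Lit public

compl : Lit → Lit
compl (lit b P ts) = lit (not b) P ts

negL : Lit → Lit
negL (lit b P ts) = lit false P ts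

substLit : (ℕ → Term) → Lit → Lit
substLit θ (lit b P ts) = lit b P (subs θ ts)

atomLit : Bool → Atom → Lit
atomLit b (atom P as) = lit b (inp P) (map argT as)

Dlit : Fm → Side → Pos → Lit
Dlit H s p = lit true (dfn s p) (map var (xs H p))

idx : ℕ → List ℕ → Maybe ℕ
idx x [] = nothing
idx x (y ∷ ys) with x ≟ y
... | Relation.Nullary.yes _ = just 0
... | Relation.Nullary.no _ = maybe (λ i → just (suc i)) nothing (idx x ys)

-- σ_{sp} for v_{sp} = v = x_1..x_n : x_i ↦ f_<sp,i>(x_{sp})  (i from 1)
σ : Fm → Side → Pos → List ℕ → ℕ → Term
σ H s p v x = maybe (λ i → sk s p (suc i) (map var (xs H p))) (var x) (idx x v)

Clause : Set
Clause = List Lit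

data ClauseOf (H : Fm) (s : Side) : Clause → Set where
  c1 : ClauseOf H s (Dlit H s [] ∷ [])
  c2 : ∀ {p} → subAt H p ≡ just ⊥ᶠ → ClauseOf H s (negL (Dlit H s p) ∷ [])
  c3 : ∀ {p A B} → subAt H p ≡ just (A ∧ᶠ B) →
       ClauseOf H s (negL (Dlit H s p) ∷ Dlit H s (p ++ 1 ∷ []) ∷ [])
  c4 : ∀ {p A B} → subAt H p ≡ just (A ∧ᶠ B) →
       ClauseOf H s (negL (Dlit H s p) ∷ Dlit H s (p ++ 2 ∷ []) ∷ [])
  c5 : ∀ {p A B} → subAt H p ≡ just (A ∨ᶠ B) →
       ClauseOf H s (negL (Dlit H s p) ∷ Dlit H s (p ++ 1 ∷ []) ∷ Dlit H s (p ++ 2 ∷ []) ∷ [])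
  c6 : ∀ {p v Rt G} → subAt H p ≡ just (∀ᶠ v Rt G) →
       ClauseOf H s (negL (Dlit H s p) ∷ atomLit false Rt ∷ Dlit H s (p ++ 1 ∷ []) ∷ [])
  c7 : ∀ {p v Rt G} → subAt H p ≡ just (∃ᶠ v Rt G) →
       ClauseOf H s (negL (Dlit H s p) ∷ substLit (σ H s p v) (atomLit true Rt) ∷ [])
  c8 : ∀ {p v Rt G} → subAt H p ≡ just (∃ᶠ v Rt G) →
       ClauseOf H s (negL (Dlit H s p) ∷ substLit (σ H s p v) (Dlit H s (p ++ 1 ∷ [])) ∷ [])

side : Fm → Fm → Side → Fm
side F G L = F
side F G R = negF G

data Node : Set where
  nd : Side → Lit → List Node → Node

nside : Node → Side
nside (nd s _ _) = s

lbl : Node → Lit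
lbl (nd _ l _) = l

kids : Node → List Node
kids (nd _ _ cs) = cs

-- a tableau is the list of the root's children (the root carries no label)
Tableau : Set
Tableau = List Node

-- Path T anc n : n is a non-root node of T; anc = labels of its non-root
-- ancestors, ordered from the root downwards (last = parent)
data Path : List Node → List Lit → Node → Set where
  here  : ∀ {ns n} → n ∈ ns → Path ns [] n
  there : ∀ {ns s l cs anc n} → nd s l cs ∈ ns → Path cs anc n → Path ns (l ∷ anc) n

_⇔_ : Set → Set → Set
A ⇔ B = (A → B) × (B → A)

Expansion : Fm → Fm → List Node → Set
Expansion F G cs =
  Σ Side λ S → All (λ c → nside c ≡ S) cs ×
  Σ Clause λ C → ClauseOf (side F G S) S C ×
  Σ (ℕ → Term) λ θ → ∀ l → (l ∈ map lbl cs) ⇔ (l ∈ map (substLit θ) C)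

TwoSidedTableau : Fm → Fm → Tableau → Set
TwoSidedTableau F G T =
  (T ≡ [] ⊎ Expansion F G T) ×
  (∀ anc n → Path T anc n → kids n ≡ [] ⊎ Expansion F G (kids n))

GroundTab : Tableau → Set
GroundTab T = ∀ anc n → Path T anc n → All GroundT (args (lbl n))

ClosedTab : Tableau → Set
ClosedTab T = T ≢ [] ×
  (∀ anc n → Path T anc n → kids n ≡ [] → Any (λ l → l ≡ compl (lbl n)) anc)

Regular : Tableau → Set
Regular T = ∀ anc n → Path T anc n → lbl n ∉ anc

LeafOnlyNeg : Tableau → Set
LeafOnlyNeg T = ∀ anc n → Path T anc n → sgn (lbl n) ≡ false → kids n ≡ []

RDPair : Fm → Fm → Lit → Lit → Set
RDPair F G l1 l2 =
  Σ Side λ s → Σ Pos λ p → Σ (List ℕ) λ v → Σ Atom λ Rt → Σ Fm λ K →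
  subAt (side F G s) p ≡ just (∃ᶠ v Rt K) × Σ (ℕ → Term) λ μ →
  l1 ≡ substLit μ (substLit (σ (side F G s) s p v) (atomLit true Rt)) ×
  l2 ≡ substLit μ (substLit (σ (side F G s) s p v) (Dlit (side F G s) s (p ++ 1 ∷ [])))

Contiguous : Fm → Fm → Tableau → Set
Contiguous F G T = ∀ anc n pre l post → Path T anc n → anc ≡ pre ++ l ∷ post →
  (RDPair F G l (lbl n) ⊎ RDPair F G (lbl n) l) → post ≡ []

ACITableau : Fm → Fm → Tableau → Set
ACITableau F G T = TwoSidedTableau F G T × ClosedTab T × GroundTab T ×
  Regular T × LeafOnlyNeg T × Contiguous F G T

Introducer : Fm → Fm → Term → Lit → Set
Introducer F G t l =
  Σ Side λ s → Σ Pos λ p → Σ (List ℕ) λ v → Σ Atom λ Rt → Σ Fm λ K →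
  subAt (side F G s) p ≡ just (∃ᶠ v Rt K) × Σ ℕ λ i → Σ (ℕ → Term) λ μ →
  t ≡ sub μ (sk s p i (map var (xs (side F G s) p))) ×
  (l ≡ substLit μ (substLit (σ (side F G s) s p v) (atomLit true Rt)) ⊎
   l ≡ substLit μ (substLit (σ (side F G s) s p v) (Dlit (side F G s) s (p ++ 1 ∷ []))))

SkolemHeaded : Term → Set
SkolemHeaded t = Σ Side λ s → Σ Pos λ p → Σ ℕ λ i → Σ (List Term) λ ts → t ≡ sk s p i ts

-- In an instance of a clause, every variable of a literal other than the leading ¬D_p
-- either occurs in ¬D_p (it is free in F|_p, hence among x_p) or in the guard ¬R_p
-- (clause 6), or it is bound at an existential position p and σ_p turns it into a
-- Skolem term (clauses 7 and 8, whose literals are then introducers).  So a Skolem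
-- term t of a node N is either introduced by N, or it occurs in a negative sibling of
-- N.  That sibling is a leaf (leaf-only) closed by a strict ancestor of N, whose label
-- is its complement and hence still contains t; induction on depth finishes.
module Submission where

open import Defs
open import Data.Bool using (true; false)
open import Data.Empty using (⊥; ⊥-elim)
open import Data.List using (List; []; _∷_; _++_; map; length)
open import Data.List.Properties using (length-++)
open import Data.List.Membership.Propositional using (_∈_; _∉_; find)
open import Data.List.Membership.Propositional.Properties
  using (∈-map⁺; ∈-map⁻; ∈-++⁺ˡ; ∈-++⁺ʳ; ∈-filter⁺; ∈-deduplicate⁺; ∈-deduplicate⁻)
open import Data.List.Relation.Binary.Subset.Propositional using (_⊆_)
open import Data.List.Relation.Unary.Any using (Any; here; there)
open import Data.List.Relation.Unary.Any.Properties using (¬Any[]; ++⁺ˡ; ++⁺ʳ)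
open import Data.Maybe using (just; nothing)
open import Data.Nat using (ℕ; suc; _<_; _≟_; z<s)
open import Data.List.Membership.DecPropositional _≟_ using (_∈?_)
open import Data.Nat.Induction using (<-wellFounded)
open import Data.Nat.Properties using (m<m+n)
open import Data.Product using (∃; ∃₂; _×_; _,_; proj₁; proj₂)
open import Data.Sum using (_⊎_; inj₁; inj₂; [_,_]′)
open import Function using (_∘_)
open import Induction.WellFounded using (Acc; acc)
open import Relation.Nullary using (¬?; yes; no)
open import Relation.Binary.PropositionalEquality using (_≡_; refl; sym; trans; cong; cong₂; subst)

mutual
  sub-∘ : ∀ θ ρ t → sub θ (sub ρ t) ≡ sub (sub θ ∘ ρ) t
  sub-∘ θ ρ (var x) = refl
  sub-∘ θ ρ (con c) = refl
  sub-∘ θ ρ (sk s p i ts) = cong (sk s p i) (subs-∘ θ ρ ts)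

  subs-∘ : ∀ θ ρ ts → subs θ (subs ρ ts) ≡ subs (sub θ ∘ ρ) ts
  subs-∘ θ ρ [] = refl
  subs-∘ θ ρ (t ∷ ts) = cong₂ _∷_ (sub-∘ θ ρ t) (subs-∘ θ ρ ts)

∈-subs-∘ : ∀ θ ρ {t} ts → t ∈ subs θ (subs ρ ts) → t ∈ subs (sub θ ∘ ρ) ts
∈-subs-∘ θ ρ ts = subst (_ ∈_) (subs-∘ θ ρ ts)

∈-subs-vars⁻ : ∀ θ ys {t} → t ∈ subs θ (map var ys) → ∃ λ y → y ∈ ys × t ≡ θ y
∈-subs-vars⁻ θ (y ∷ ys) (here t≡) = y , here refl , t≡
∈-subs-vars⁻ θ (y ∷ ys) (there t∈) with ∈-subs-vars⁻ θ ys t∈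
... | y′ , y′∈ys , t≡ = y′ , there y′∈ys , t≡

∈-subs-vars⁺ : ∀ θ {y ys} → y ∈ ys → θ y ∈ subs θ (map var ys)
∈-subs-vars⁺ θ (here refl) = here refl
∈-subs-vars⁺ θ (there y∈ys) = there (∈-subs-vars⁺ θ y∈ys)

∈-subs-argT⁻ : ∀ θ as {t} → t ∈ subs θ (map argT as) →
               (∃ λ c → t ≡ con c) ⊎ (∃ λ x → x ∈ varsArgs as × t ≡ θ x)
∈-subs-argT⁻ θ (avar x ∷ as) (here t≡) = inj₂ (x , here refl , t≡)
∈-subs-argT⁻ θ (acon c ∷ as) (here t≡) = inj₁ (c , t≡)
∈-subs-argT⁻ θ (avar x ∷ as) (there t∈) with ∈-subs-argT⁻ θ as t∈
... | inj₁ constant = inj₁ constant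
... | inj₂ (y , y∈as , t≡) = inj₂ (y , there y∈as , t≡)
∈-subs-argT⁻ θ (acon c ∷ as) (there t∈) = ∈-subs-argT⁻ θ as t∈

∈-subs-argT⁺ : ∀ θ as {y} → y ∈ varsArgs as → θ y ∈ subs θ (map argT as)
∈-subs-argT⁺ θ (avar x ∷ as) (here refl) = here refl
∈-subs-argT⁺ θ (avar x ∷ as) (there y∈as) = there (∈-subs-argT⁺ θ as y∈as)
∈-subs-argT⁺ θ (acon c ∷ as) y∈as = there (∈-subs-argT⁺ θ as y∈as)

subAt-++ : ∀ H p q {K} → subAt H p ≡ just K → subAt H (p ++ q) ≡ subAt K q
subAt-++ H [] q refl = refl
subAt-++ ⊤ᶠ (_ ∷ p) q ()
subAt-++ ⊥ᶠ (_ ∷ p) q ()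
subAt-++ (A ∧ᶠ B) (0 ∷ p) q ()
subAt-++ (A ∧ᶠ B) (1 ∷ p) q e = subAt-++ A p q e
subAt-++ (A ∧ᶠ B) (2 ∷ p) q e = subAt-++ B p q e
subAt-++ (A ∧ᶠ B) (suc (suc (suc _)) ∷ p) q ()
subAt-++ (A ∨ᶠ B) (0 ∷ p) q ()
subAt-++ (A ∨ᶠ B) (1 ∷ p) q e = subAt-++ A p q e
subAt-++ (A ∨ᶠ B) (2 ∷ p) q e = subAt-++ B p q e
subAt-++ (A ∨ᶠ B) (suc (suc (suc _)) ∷ p) q ()
subAt-++ (∀ᶠ v Rt K) (0 ∷ p) q ()
subAt-++ (∀ᶠ v Rt K) (1 ∷ p) q e = subAt-++ K p q e
subAt-++ (∀ᶠ v Rt K) (suc (suc _) ∷ p) q ()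
subAt-++ (∃ᶠ v Rt K) (0 ∷ p) q ()
subAt-++ (∃ᶠ v Rt K) (1 ∷ p) q e = subAt-++ K p q e
subAt-++ (∃ᶠ v Rt K) (suc (suc _) ∷ p) q ()

RQFO-subAt : ∀ {H K} p → RQFO H → subAt H p ≡ just K → RQFO K
RQFO-subAt [] r refl = r
RQFO-subAt {⊤ᶠ} (_ ∷ p) r ()
RQFO-subAt {⊥ᶠ} (_ ∷ p) r ()
RQFO-subAt {A ∧ᶠ B} (0 ∷ p) r ()
RQFO-subAt {A ∧ᶠ B} (1 ∷ p) (rq∧ a b) e = RQFO-subAt p a e
RQFO-subAt {A ∧ᶠ B} (2 ∷ p) (rq∧ a b) e = RQFO-subAt p b e
RQFO-subAt {A ∧ᶠ B} (suc (suc (suc _)) ∷ p) r ()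
RQFO-subAt {A ∨ᶠ B} (0 ∷ p) r ()
RQFO-subAt {A ∨ᶠ B} (1 ∷ p) (rq∨ a b) e = RQFO-subAt p a e
RQFO-subAt {A ∨ᶠ B} (2 ∷ p) (rq∨ a b) e = RQFO-subAt p b e
RQFO-subAt {A ∨ᶠ B} (suc (suc (suc _)) ∷ p) r ()
RQFO-subAt {∀ᶠ v Rt K} (0 ∷ p) r ()
RQFO-subAt {∀ᶠ v Rt K} (1 ∷ p) (rq∀ _ _ k) e = RQFO-subAt p k e
RQFO-subAt {∀ᶠ v Rt K} (suc (suc _) ∷ p) r ()
RQFO-subAt {∃ᶠ v Rt K} (0 ∷ p) r ()
RQFO-subAt {∃ᶠ v Rt K} (1 ∷ p) (rq∃ _ _ k) e = RQFO-subAt p k e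
RQFO-subAt {∃ᶠ v Rt K} (suc (suc _) ∷ p) r ()

RQFO-negF : ∀ {G} → RQFO G → RQFO (negF G)
RQFO-negF rq⊤ = rq⊥
RQFO-negF rq⊥ = rq⊤
RQFO-negF (rq∧ a b) = rq∨ (RQFO-negF a) (RQFO-negF b)
RQFO-negF (rq∨ a b) = rq∧ (RQFO-negF a) (RQFO-negF b)
RQFO-negF (rq∀ u g k) = rq∃ u g (RQFO-negF k)
RQFO-negF (rq∃ u g k) = rq∀ u g (RQFO-negF k)

fv-negF : ∀ G → fv (negF G) ≡ fv G
fv-negF ⊤ᶠ = refl
fv-negF ⊥ᶠ = refl
fv-negF (A ∧ᶠ B) = cong₂ _++_ (fv-negF A) (fv-negF B)
fv-negF (A ∨ᶠ B) = cong₂ _++_ (fv-negF A) (fv-negF B)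
fv-negF (∀ᶠ v Rt K) = cong (λ ys → minus (varsArgs (argsA Rt) ++ ys) v) (fv-negF K)
fv-negF (∃ᶠ v Rt K) = cong (λ ys → minus (varsArgs (argsA Rt) ++ ys) v) (fv-negF K)

side-RQFOSentence : ∀ {F G} → RQFOSentence F → RQFOSentence G → ∀ s → RQFOSentence (side F G s)
side-RQFOSentence sF sG L = sF
side-RQFOSentence {G = G} sF (rG , closedG) R = RQFO-negF rG , trans (fv-negF G) closedG

∈-minus⁺ : ∀ {y ys v} → y ∈ ys → y ∉ v → y ∈ minus ys v
∈-minus⁺ {v = v} = ∈-filter⁺ (λ x → ¬? (x ∈? v))

xs-⊆-fv : ∀ H p {K y} → subAt H p ≡ just K → y ∈ xs H p → y ∈ fv K
xs-⊆-fv H p e y∈xs rewrite e = ∈-deduplicate⁻ _≟_ _ y∈xs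

fv-⊆-xs : ∀ H p {K y} → subAt H p ≡ just K → y ∈ fv K → y ∈ xs H p
fv-⊆-xs H p e y∈K rewrite e = ∈-deduplicate⁺ _≟_ y∈K

idx-∈ : ∀ {x v} → x ∈ v → ∃ λ i → idx x v ≡ just i
idx-∈ {x} {y ∷ v} x∈v with x ≟ y
... | yes _ = 0 , refl
... | no x≢y with x∈v
...   | here x≡y = ⊥-elim (x≢y x≡y)
...   | there x∈v′ with idx x v | idx-∈ x∈v′
...     | just i | _ = suc i , refl
...     | nothing | _ , ()

σ-skolem-or-var : ∀ H s p v x →
  (∃ λ i → σ H s p v x ≡ sk s p (suc i) (map var (xs H p))) ⊎ (σ H s p v x ≡ var x × x ∉ v)
σ-skolem-or-var H s p v x with idx x v in e
... | just i = inj₁ (i , refl)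
... | nothing = inj₂ (refl , λ x∈v → nothing≢just (trans (sym e) (proj₂ (idx-∈ x∈v))))
  where
  nothing≢just : ∀ {i : ℕ} → nothing ≡ just i → ⊥
  nothing≢just ()

∈-args-cong : ∀ {t l l′} → l ≡ l′ → t ∈ args l → t ∈ args l′
∈-args-cong {t} = subst (λ l → t ∈ args l)

OccursNegatively : (ℕ → Term) → Term → Clause → Set
OccursNegatively θ t = Any (λ d → sgn d ≡ false × t ∈ args (substLit θ d))

module _ {F G : Fm} {s : Side} (sentence : RQFOSentence (side F G s)) (θ : ℕ → Term) where

  private
    H : Fm
    H = side F G s

  head-occurrence : ∀ {p K y ls} → subAt H p ≡ just K → y ∈ fv K →
                    OccursNegatively θ (θ y) (negL (Dlit H s p) ∷ ls)
  head-occurrence {p} e y∈K = here (refl , ∈-subs-vars⁺ θ (fv-⊆-xs H p e y∈K))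

  fv-child : ∀ p j {K A y} → subAt H p ≡ just K → subAt K (j ∷ []) ≡ just A →
             y ∈ xs H (p ++ j ∷ []) → y ∈ fv A
  fv-child p j e e′ = xs-⊆-fv H (p ++ j ∷ []) (trans (subAt-++ H p (j ∷ []) e) e′)

  ∀-guard-binds : ∀ p {v Rt K} → subAt H p ≡ just (∀ᶠ v Rt K) → v ⊆ varsArgs (argsA Rt)
  ∀-guard-binds p e with RQFO-subAt p (proj₁ sentence) e
  ... | rq∀ _ guarded _ = guarded

  skolemised : ∀ {p v Rt K x t l ls} → subAt H p ≡ just (∃ᶠ v Rt K) →
    l ≡ substLit θ (substLit (σ H s p v) (atomLit true Rt)) ⊎
    l ≡ substLit θ (substLit (σ H s p v) (Dlit H s (p ++ 1 ∷ []))) →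
    (x ∉ v → x ∈ fv (∃ᶠ v Rt K)) → t ≡ sub θ (σ H s p v x) →
    Introducer F G t l ⊎ OccursNegatively θ t (negL (Dlit H s p) ∷ ls)
  skolemised {p} {v} {x = x} e introducing free t≡ with σ-skolem-or-var H s p v x
  ... | inj₁ (i , σx≡) = inj₁ (s , p , v , _ , _ , e , suc i , θ , trans t≡ (cong (sub θ) σx≡) , introducing)
  ... | inj₂ (σx≡ , x∉v) =
    inj₂ (subst (λ u → OccursNegatively θ u _) (sym (trans t≡ (cong (sub θ) σx≡)))
                (head-occurrence e (free x∉v)))

  skolem-in-clause : ∀ {C c t} → ClauseOf H s C → c ∈ C → t ∈ args (substLit θ c) → SkolemHeaded t →
                     Introducer F G t (substLit θ c) ⊎ OccursNegatively θ t C
  skolem-in-clause c1 (here refl) t∈ _ with ∈-subs-vars⁻ θ (xs H []) t∈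
  ... | y , y∈xs , _ = ⊥-elim (¬Any[] (subst (y ∈_) (proj₂ sentence) (xs-⊆-fv H [] refl y∈xs)))
  skolem-in-clause (c2 _) (here refl) t∈ _ = inj₂ (here (refl , t∈))
  skolem-in-clause (c3 _) (here refl) t∈ _ = inj₂ (here (refl , t∈))
  skolem-in-clause (c3 {p} e) (there (here refl)) t∈ _ with ∈-subs-vars⁻ θ _ t∈
  ... | y , y∈xs , refl = inj₂ (head-occurrence e (∈-++⁺ˡ (fv-child p 1 e refl y∈xs)))
  skolem-in-clause (c4 _) (here refl) t∈ _ = inj₂ (here (refl , t∈))
  skolem-in-clause (c4 {p} {A} e) (there (here refl)) t∈ _ with ∈-subs-vars⁻ θ _ t∈
  ... | y , y∈xs , refl = inj₂ (head-occurrence e (∈-++⁺ʳ (fv A) (fv-child p 2 e refl y∈xs)))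
  skolem-in-clause (c5 _) (here refl) t∈ _ = inj₂ (here (refl , t∈))
  skolem-in-clause (c5 {p} e) (there (here refl)) t∈ _ with ∈-subs-vars⁻ θ _ t∈
  ... | y , y∈xs , refl = inj₂ (head-occurrence e (∈-++⁺ˡ (fv-child p 1 e refl y∈xs)))
  skolem-in-clause (c5 {p} {A} e) (there (there (here refl))) t∈ _ with ∈-subs-vars⁻ θ _ t∈
  ... | y , y∈xs , refl = inj₂ (head-occurrence e (∈-++⁺ʳ (fv A) (fv-child p 2 e refl y∈xs)))
  skolem-in-clause (c6 _) (here refl) t∈ _ = inj₂ (here (refl , t∈))
  skolem-in-clause (c6 _) (there (here refl)) t∈ _ = inj₂ (there (here (refl , t∈)))
  skolem-in-clause (c6 {p} {v} {Rt} e) (there (there (here refl))) t∈ _ with ∈-subs-vars⁻ θ _ t∈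
  ... | y , y∈xs , refl with y ∈? v
  ...   | yes y∈v = inj₂ (there (here (refl , ∈-subs-argT⁺ θ (argsA Rt) (∀-guard-binds p e y∈v))))
  ...   | no y∉v = inj₂ (head-occurrence e
                      (∈-minus⁺ (∈-++⁺ʳ (varsArgs (argsA Rt)) (fv-child p 1 e refl y∈xs)) y∉v))
  skolem-in-clause (c7 _) (here refl) t∈ _ = inj₂ (here (refl , t∈))
  skolem-in-clause (c7 {p} {v} {Rt} e) (there (here refl)) t∈ (_ , _ , _ , _ , refl)
    with ∈-subs-argT⁻ (sub θ ∘ σ H s p v) (argsA Rt) (∈-subs-∘ θ (σ H s p v) _ t∈)
  ... | inj₁ (_ , ())
  ... | inj₂ (x , x∈Rt , t≡) = skolemised e (inj₁ refl) (∈-minus⁺ (∈-++⁺ˡ x∈Rt)) t≡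
  skolem-in-clause (c8 _) (here refl) t∈ _ = inj₂ (here (refl , t∈))
  skolem-in-clause (c8 {p} {v} {Rt} e) (there (here refl)) t∈ _
    with ∈-subs-vars⁻ (sub θ ∘ σ H s p v) _ (∈-subs-∘ θ (σ H s p v) _ t∈)
  ... | y , y∈xs , t≡ =
    skolemised e (inj₂ refl) (∈-minus⁺ (∈-++⁺ʳ (varsArgs (argsA Rt)) (fv-child p 1 e refl y∈xs))) t≡

length-<-++-∷ : ∀ {A : Set} (xs : List A) {y} ys → length xs < length (xs ++ y ∷ ys)
length-<-++-∷ xs ys = subst (length xs <_) (sym (length-++ xs)) (m<m+n (length xs) z<s)

AncestorWith : Tableau → List Lit → (Lit → Set) → Set
AncestorWith T anc P =
  ∃₂ λ pre post → ∃ λ n → anc ≡ pre ++ lbl n ∷ post × Path T pre n × P (lbl n)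

ancestor-with : ∀ {T anc n} {P : Lit → Set} → Path T anc n → Any P anc → AncestorWith T anc P
ancestor-with (there e _) (here p) = [] , _ , _ , refl , here e , p
ancestor-with (there e path) (there a) with ancestor-with path a
... | pre , post , n , refl , path′ , p = _ ∷ pre , post , n , refl , there e path′ , p

closing-ancestor : ∀ {T anc m} → ClosedTab T → LeafOnlyNeg T → Path T anc m →
                   sgn (lbl m) ≡ false → AncestorWith T anc (_≡ compl (lbl m))
closing-ancestor (_ , closed) leafOnly path negative =
  ancestor-with path (closed _ _ path (leafOnly _ _ path negative))

module _ {F G : Fm} where

  subtree-TwoSided : ∀ {T s l cs} → TwoSidedTableau F G T → nd s l cs ∈ T → TwoSidedTableau F G cs
  subtree-TwoSided (_ , expands) e = expands [] _ (here e) , λ anc n path → expands _ n (there e path)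

  nonempty-Expansion : ∀ {cs n} → n ∈ cs → cs ≡ [] ⊎ Expansion F G cs → Expansion F G cs
  nonempty-Expansion n∈cs (inj₁ refl) = ⊥-elim (¬Any[] n∈cs)
  nonempty-Expansion _ (inj₂ expansion) = expansion

  siblings : ∀ {T anc n} → TwoSidedTableau F G T → Path T anc n →
    ∃ λ cs → n ∈ cs × (∀ {m} → m ∈ cs → Path T anc m) × Expansion F G cs
  siblings (root , _) (here n∈T) = _ , n∈T , here , nonempty-Expansion n∈T root
  siblings tableau (there e path) with siblings (subtree-TwoSided tableau e) path
  ... | cs , n∈cs , reach , expansion = cs , n∈cs , there e ∘ reach , expansion

module _ {F G : Fm} (sF : RQFOSentence F) (sG : RQFOSentence G) {T : Tableau}
         (tableau : TwoSidedTableau F G T) (closedTab : ClosedTab T) (leafOnly : LeafOnlyNeg T) where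

  skolem-introduced-or-inherited : ∀ {anc n t} → Path T anc n → t ∈ args (lbl n) → SkolemHeaded t →
    Introducer F G t (lbl n) ⊎ AncestorWith T anc (λ l → t ∈ args l)
  skolem-introduced-or-inherited {n = n} {t} path t∈n skolem with siblings tableau path
  ... | cs , n∈cs , reach , S , _ , C , clause , θ , instance′
    with ∈-map⁻ (substLit θ) (proj₁ (instance′ (lbl n)) (∈-map⁺ lbl n∈cs))
  ... | c , c∈C , n≡c
    with skolem-in-clause (side-RQFOSentence sF sG S) θ clause c∈C (∈-args-cong n≡c t∈n) skolem
  ... | inj₁ introducer = inj₁ (subst (Introducer F G t) (sym n≡c) introducer)
  ... | inj₂ occurrence with find occurrence
  ... | d , d∈C , negative , t∈d
    with ∈-map⁻ lbl (proj₂ (instance′ (substLit θ d)) (∈-map⁺ (substLit θ) d∈C))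
  ... | m , m∈cs , d≡m with closing-ancestor closedTab leafOnly (reach m∈cs) (trans (cong sgn (sym d≡m)) negative)
  ... | pre , post , n′ , anc≡ , path′ , n′≡ =
    inj₂ (pre , post , n′ , anc≡ , path′ , ∈-args-cong (sym n′≡) (∈-args-cong d≡m t∈d))

  skolem-has-introducer : ∀ {anc n t} → Path T anc n → t ∈ args (lbl n) → SkolemHeaded t →
    Introducer F G t (lbl n) ⊎ Any (Introducer F G t) anc
  skolem-has-introducer {anc} {t = t} path t∈n skolem = go (<-wellFounded (length anc)) path t∈n
    where
    go : ∀ {anc n} → Acc _<_ (length anc) → Path T anc n → t ∈ args (lbl n) →
         Introducer F G t (lbl n) ⊎ Any (Introducer F G t) anc
    go (acc shorter) path t∈n with skolem-introduced-or-inherited path t∈n skolem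
    ... | inj₁ introducer = inj₁ introducer
    ... | inj₂ (pre , post , _ , refl , path′ , t∈n′) =
      inj₂ ([ ++⁺ʳ pre ∘ here , ++⁺ˡ ]′ (go (shorter (length-<-++-∷ pre post)) path′ t∈n′))

proposition9 : (F G : Fm) → RQFOSentence F → RQFOSentence G →
    (T : Tableau) → ACITableau F G T →
    (anc : List Lit) (n : Node) → Path T anc n →
    (t : Term) → t ∈ args (lbl n) → SkolemHeaded t →
    Introducer F G t (lbl n) ⊎ Any (Introducer F G t) anc
proposition9 F G sF sG T (tableau , closedTab , _ , _ , leafOnly , _) anc n path t =
  skolem-has-introducer sF sG tableau closedTab leafOnly path
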